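{- Let $n\in\mathbb{Z}^+$. For every function $f:\mathbb{Z}\to\mathbb{Z}$, $f\in F_n(\mathbb{Z})$ if and only if (1) for all $a\in f[\mathbb{Z}]$, the preimage $f^{ -1}[a]$ is finite (equivalently, a bounded interval), and (2) for all $x,y,k\in\mathbb{Z}$, $x\le y+kn$ implies $f(x)\le f(y)+kn$.
   Context: For an order-preserving map $f$ on a chain, the residual is $f^r(b)=\max\{a:f(a)\le b\}$ and the dual residual is $f^\ell(a)=\min\{b:a\le f(b)\}$, when they exist. $F(\mathbb{Z})$ is the set of maps on $\mathbb{Z}$ having residuals and dual residuals of all orders, and $F_n(\mathbb{Z})$ is the set of $f\in F(\mathbb{Z})$ with $f^{\ell^n}=f^{r^n}$. -}

module Defs where

open import Data.Integer using (ℤ; _≤_; _+_; _*_; +_)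
open import Data.Nat using (ℕ; suc)
open import Data.List using (List)
open import Data.List.Membership.Propositional using (_∈_)
open import Data.Product using (Σ; ∃; _×_)
open import Relation.Binary.PropositionalEquality using (_≡_)

OrderPreserving : (ℤ → ℤ) → Set
OrderPreserving f = ∀ {x y} → x ≤ y → f x ≤ f y

IsResidual : (ℤ → ℤ) → (ℤ → ℤ) → Set
IsResidual f g = ∀ b → (f (g b) ≤ b) × (∀ a → f a ≤ b → a ≤ g b)

IsDualResidual : (ℤ → ℤ) → (ℤ → ℤ) → Set
IsDualResidual f g = ∀ a → (a ≤ f (g a)) × (∀ b → a ≤ f b → g a ≤ b)

IsResidualSeq : (ℤ → ℤ) → (ℕ → ℤ → ℤ) → Set
IsResidualSeq f R = (∀ x → R 0 x ≡ f x) × (∀ k → IsResidual (R k) (R (suc k)))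

IsDualResidualSeq : (ℤ → ℤ) → (ℕ → ℤ → ℤ) → Set
IsDualResidualSeq f L = (∀ x → L 0 x ≡ f x) × (∀ k → IsDualResidual (L k) (L (suc k)))

InF : (ℤ → ℤ) → Set
InF f = OrderPreserving f
      × Σ (ℕ → ℤ → ℤ) (λ R → IsResidualSeq f R)
      × Σ (ℕ → ℤ → ℤ) (λ L → IsDualResidualSeq f L)

-- f ∈ F_n(ℤ): f ∈ F(ℤ) and f^{ℓ^n} = f^{r^n}
-- (residuals are unique when they exist, so the iterates are determined by f)
InFn : ℕ → (ℤ → ℤ) → Set
InFn n f = OrderPreserving f
         × Σ (ℕ → ℤ → ℤ) (λ R → Σ (ℕ → ℤ → ℤ) (λ L →
             IsResidualSeq f R × IsDualResidualSeq f L × (∀ x → L n x ≡ R n x)))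

FiniteSet : (ℤ → Set) → Set
FiniteSet P = ∃ λ (xs : List ℤ) → ∀ x → P x → x ∈ xs

Preimage : (ℤ → ℤ) → ℤ → ℤ → Set
Preimage f a x = f x ≡ a

-- On ℤ, an order-preserving g with residual h has dual residual x ↦ h (x - 1) + 1, and
-- translating graphs by (c , c) commutes with taking (dual) residuals.  Hence f^{ℓ^k} is
-- f^{r^k} translated by (k , k), and f^{ℓ^n} = f^{r^n} says that f^{r^n} commutes with
-- translation by n.  By the Galois correspondence this property passes along residuals in
-- both directions, so it is equivalent to f (x + n) = f x + n, which together with
-- monotonicity is condition (2).  Conversely, such an f has fibres of length at most 2n,
-- and residuals obtained by a bounded search, which again commute with translation by n.
module Submission where

open import Defs
open import Data.Nat using (ℕ)
open import Data.Integer using (ℤ; _≤_; _+_; _*_; +_)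
open import Data.Product using (_×_; ∃)
open import Relation.Binary.PropositionalEquality using (_≡_)
open import Function.Bundles using (_⇔_)

import Data.Nat as ℕ
open import Data.Integer using (+<+; _<_; _-_; -_; -[1+_]; 0ℤ; 1ℤ; -1ℤ; suc; pred; ∣_∣; _≤?_; _/ℕ_)
open import Data.Integer.Properties
  using (≤-refl; ≤-trans; ≤-antisym; ≤-reflexive; <⇒≤; ≰⇒>; <⇒≱; ≤∧≢⇒<;
         i<j⇒suc[i]≤j; i<j⇒i≤pred[j]; suc[i]≤j⇒i<j; +-monoˡ-≤; +-monoʳ-≤; +-monoʳ-<;
         +-identityˡ; +-identityʳ; 0≤i⇒+∣i∣≡i; i≤j⇒0≤j-i; drop‿+<+; module ≤-Reasoning)
import Data.Integer.Properties as ℤ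
open import Data.Integer.DivMod using ([n/ℕd]*d≤n; n<s[n/ℕd]*d)
open import Data.Integer.Tactic.RingSolver using (solve-∀)
open import Data.List using (applyUpTo)
open import Data.List.Membership.Propositional using (_∈_)
open import Data.List.Membership.Propositional.Properties using (∈-applyUpTo⁺)
open import Data.Product using (Σ; _,_; proj₁; proj₂)
open import Relation.Binary.PropositionalEquality
  using (module ≡-Reasoning; refl; sym; trans; cong; subst; subst₂; _≗_)
open import Relation.Nullary using (yes; no; ¬_)
open import Relation.Unary using (Decidable)
open import Function.Bundles using (mk⇔; Equivalence)

variable
  f g h h′ : ℤ → ℤ
  a b c p : ℤ

i≤j+k⇒i-k≤j : a ≤ b + c → a - c ≤ b
i≤j+k⇒i-k≤j {a} {b} {c} le = subst (a - c ≤_) (cancel b c) (+-monoˡ-≤ (- c) le)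
  where cancel : ∀ b c → b + c - c ≡ b
        cancel = solve-∀

i-k≤j⇒i≤j+k : a - c ≤ b → a ≤ b + c
i-k≤j⇒i≤j+k {a} {c} {b} le = subst (_≤ b + c) (cancel a c) (+-monoˡ-≤ c le)
  where cancel : ∀ a c → a - c + c ≡ a
        cancel = solve-∀

i≤j-k⇒i+k≤j : a ≤ b - c → a + c ≤ b
i≤j-k⇒i+k≤j {a} {b} {c} le = subst (a + c ≤_) (cancel b c) (+-monoˡ-≤ c le)
  where cancel : ∀ b c → b - c + c ≡ b
        cancel = solve-∀

residual-monotone : IsResidual g h → OrderPreserving h
residual-monotone {g} {h} res {x} {y} x≤y = proj₂ (res y) (h x) (≤-trans (proj₁ (res x)) x≤y)

dualResidual-unique : IsDualResidual g h → IsDualResidual g h′ → h ≗ h′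
dualResidual-unique dual dual′ a =
  ≤-antisym (proj₂ (dual a) _ (proj₁ (dual′ a))) (proj₂ (dual′ a) _ (proj₁ (dual a)))

dualResidual-resp-≗ : g ≗ f → IsDualResidual g h → IsDualResidual f h
dualResidual-resp-≗ {g} {f} {h} g≗f dual a =
  subst (a ≤_) (g≗f (h a)) (proj₁ (dual a)) ,
  λ b a≤fb → proj₂ (dual a) b (subst (a ≤_) (sym (g≗f b)) a≤fb)

residual-galois : OrderPreserving g → IsResidual g h → g a ≤ b ⇔ a ≤ h b
residual-galois {g} {h} {a} {b} mono res =
  mk⇔ (proj₂ (res b) a) (λ a≤hb → ≤-trans (mono a≤hb) (proj₁ (res b)))

residual-galois-< : OrderPreserving g → IsResidual g h → b < g a ⇔ h b < a
residual-galois-< {g} {h} {b} {a} mono res = mk⇔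
  (λ b<ga → ≰⇒> λ a≤hb → <⇒≱ b<ga (Equivalence.from (residual-galois mono res) a≤hb))
  (λ hb<a → ≰⇒> λ ga≤b → <⇒≱ hb<a (Equivalence.to (residual-galois mono res) ga≤b))

shift : ℤ → (ℤ → ℤ) → ℤ → ℤ
shift c g x = g (x - c) + c

shift-zero : ∀ g → shift 0ℤ g ≗ g
shift-zero g x = trans (+-identityʳ _) (cong g (+-identityʳ x))

dualResidual-shift : OrderPreserving g → IsResidual g h →
                     ∀ c → IsDualResidual (shift c g) (shift (1ℤ + c) h)
dualResidual-shift {g} {h} mono res c a = above , least
  where
  open ≤-Reasoning
  u = a - (1ℤ + c)
  m = h u
  galois< : ∀ {b a} → b < g a ⇔ h b < a
  galois< = residual-galois-< mono res
  suc[a-[1+c]]≡a-c : ∀ a c → 1ℤ + (a - (1ℤ + c)) ≡ a - c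
  suc[a-[1+c]]≡a-c = solve-∀
  m+[1+c]-c≡suc[m] : ∀ m c → m + (1ℤ + c) - c ≡ 1ℤ + m
  m+[1+c]-c≡suc[m] = solve-∀
  suc[m]+c≡m+[1+c] : ∀ m c → 1ℤ + m + c ≡ m + (1ℤ + c)
  suc[m]+c≡m+[1+c] = solve-∀
  above : a ≤ shift c g (shift (1ℤ + c) h a)
  above = i-k≤j⇒i≤j+k (begin
    a - c                 ≡⟨ suc[a-[1+c]]≡a-c a c ⟨
    suc u                 ≤⟨ i<j⇒suc[i]≤j (Equivalence.from galois< (suc[i]≤j⇒i<j ≤-refl)) ⟩
    g (suc m)             ≡⟨ cong g (m+[1+c]-c≡suc[m] m c) ⟨
    g (m + (1ℤ + c) - c)  ∎)
  least : ∀ b → a ≤ shift c g b → shift (1ℤ + c) h a ≤ b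
  least b a≤gb = subst (_≤ b) (suc[m]+c≡m+[1+c] m c)
    (i≤j-k⇒i+k≤j (i<j⇒suc[i]≤j (Equivalence.to galois< u<g[b-c])))
    where
    u<g[b-c] : u < g (b - c)
    u<g[b-c] = suc[i]≤j⇒i<j
      (subst (_≤ g (b - c)) (sym (suc[a-[1+c]]≡a-c a c)) (i≤j+k⇒i-k≤j a≤gb))

Equivariant : ℤ → (ℤ → ℤ) → Set
Equivariant p g = ∀ x → g (x + p) ≡ g x + p

equivariant⇒shift-invariant : Equivariant p g → shift p g ≗ g
equivariant⇒shift-invariant {p} {g} equi x = begin
  g (x - p) + p  ≡⟨ equi (x - p) ⟨
  g (x - p + p)  ≡⟨ cong g (cancel x p) ⟩
  g x            ∎
  where
  open ≡-Reasoning
  cancel : ∀ x p → x - p + p ≡ x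
  cancel = solve-∀

shift-invariant⇒equivariant : shift p g ≗ g → Equivariant p g
shift-invariant⇒equivariant {p} {g} inv x = begin
  g (x + p)          ≡⟨ inv (x + p) ⟨
  g (x + p - p) + p  ≡⟨ cong (λ y → g y + p) (cancel x p) ⟩
  g x + p            ∎
  where
  open ≡-Reasoning
  cancel : ∀ x p → x + p - p ≡ x
  cancel = solve-∀

equivariant-neg : Equivariant p g → Equivariant (- p) g
equivariant-neg {p} {g} equi x = begin
  g (x - p)          ≡⟨ cancel (g (x - p)) p ⟨
  g (x - p) + p - p  ≡⟨ cong (_- p) (equivariant⇒shift-invariant {p} {g} equi x) ⟩
  g x - p            ∎
  where
  open ≡-Reasoning
  cancel : ∀ y p → y + p - p ≡ y
  cancel = solve-∀

equivariant-*ℕ : Equivariant p g → ∀ m → Equivariant (+ m * p) g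
equivariant-*ℕ {p} {g} equi ℕ.zero x = trans (cong g (+-identityʳ x)) (sym (+-identityʳ (g x)))
equivariant-*ℕ {p} {g} equi (ℕ.suc m) x = begin
  g (x + (1ℤ + + m) * p)    ≡⟨ cong g (distrib x p (+ m)) ⟩
  g (x + p + + m * p)       ≡⟨ equivariant-*ℕ {p} {g} equi m (x + p) ⟩
  g (x + p) + + m * p       ≡⟨ cong (_+ + m * p) (equi x) ⟩
  g x + p + + m * p         ≡⟨ distrib (g x) p (+ m) ⟨
  g x + (1ℤ + + m) * p      ∎
  where
  open ≡-Reasoning
  distrib : ∀ x p m → x + (1ℤ + m) * p ≡ x + p + m * p
  distrib = solve-∀

equivariant-* : Equivariant p g → ∀ k → Equivariant (k * p) g
equivariant-* {p} {g} equi (+ m) = equivariant-*ℕ {p} {g} equi m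
equivariant-* {p} {g} equi -[1+ m ] =
  subst (λ q → Equivariant q g) (neg-swap (+ ℕ.suc m) p)
    (equivariant-*ℕ {p = - p} {g} (equivariant-neg {p} {g} equi) (ℕ.suc m))
  where
  neg-swap : ∀ k p → k * (- p) ≡ (- k) * p
  neg-swap = solve-∀

residual-equivariant : OrderPreserving g → IsResidual g h → Equivariant p g → Equivariant p h
residual-equivariant {g} {h} {p} mono res equi b = ≤-antisym ≤-shifted ≥-shifted
  where
  galois : ∀ {a b} → g a ≤ b ⇔ a ≤ h b
  galois = residual-galois mono res
  ≤-shifted : h (b + p) ≤ h b + p
  ≤-shifted = i-k≤j⇒i≤j+k (Equivalence.to galois
    (subst (_≤ b) (sym (equivariant-neg {p} {g} equi (h (b + p))))
      (i≤j+k⇒i-k≤j (proj₁ (res (b + p))))))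
  ≥-shifted : h b + p ≤ h (b + p)
  ≥-shifted = Equivalence.to galois
    (subst (_≤ b + p) (sym (equi (h b))) (+-monoˡ-≤ p (proj₁ (res b))))

equivariant-of-residual : OrderPreserving g → IsResidual g h → Equivariant p h → Equivariant p g
equivariant-of-residual {g} {h} {p} mono res equi x = ≤-antisym ≤-shifted ≥-shifted
  where
  galois : ∀ {a b} → g a ≤ b ⇔ a ≤ h b
  galois = residual-galois mono res
  ≤-shifted : g (x + p) ≤ g x + p
  ≤-shifted = Equivalence.from galois
    (subst (x + p ≤_) (sym (equi (g x))) (+-monoˡ-≤ p (Equivalence.to galois ≤-refl)))
  ≥-shifted : g x + p ≤ g (x + p)
  ≥-shifted = i≤j-k⇒i+k≤j (Equivalence.from galois (begin
    x                    ≡⟨ cancel x p ⟨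
    x + p - p            ≤⟨ +-monoˡ-≤ (- p) (Equivalence.to galois ≤-refl) ⟩
    h (g (x + p)) - p    ≡⟨ equivariant-neg {p} {h} equi (g (x + p)) ⟨
    h (g (x + p) - p)    ∎))
    where
    open ≤-Reasoning
    cancel : ∀ x p → x + p - p ≡ x
    cancel = solve-∀

monotone-equivariant⇔ : (OrderPreserving g × Equivariant p g) ⇔
                        (∀ x y k → x ≤ y + k * p → g x ≤ g y + k * p)
monotone-equivariant⇔ {g} {p} = mk⇔ to from
  where
  to : OrderPreserving g × Equivariant p g → ∀ x y k → x ≤ y + k * p → g x ≤ g y + k * p
  to (mono , equi) x y k le = subst (g x ≤_) (equivariant-* {p} {g} equi k y) (mono le)
  from : (∀ x y k → x ≤ y + k * p → g x ≤ g y + k * p) → OrderPreserving g × Equivariant p g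
  from bound = mono , equi
    where
    mono : OrderPreserving g
    mono {x} {y} x≤y = subst (g x ≤_) (+-identityʳ (g y))
      (bound x y 0ℤ (subst (x ≤_) (sym (+-identityʳ y)) x≤y))
    equi : Equivariant p g
    equi x = ≤-antisym
      (subst (λ q → g (x + p) ≤ g x + q) (ℤ.*-identityˡ p)
        (bound (x + p) x 1ℤ (≤-reflexive (cong (λ q → x + q) (sym (ℤ.*-identityˡ p))))))
      (i≤j-k⇒i+k≤j (subst (λ q → g x ≤ g (x + p) + q) (ℤ.-1*i≡-i p)
        (bound x (x + p) -1ℤ (≤-reflexive (cancel x p)))))
      where
      cancel : ∀ x p → x ≡ x + p + -1ℤ * p
      cancel = solve-∀

∈-interval : ∀ {lo x} m → lo ≤ x → x < lo + + m → x ∈ applyUpTo (λ i → lo + + i) m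
∈-interval {lo} {x} m lo≤x x<lo+m =
  subst (_∈ applyUpTo (λ i → lo + + i) m) lo+d≡x (∈-applyUpTo⁺ (λ i → lo + + i) d<m)
  where
  d = ∣ x - lo ∣
  cancel : ∀ lo x → lo + (x - lo) ≡ x
  cancel = solve-∀
  cancel′ : ∀ lo q → - lo + (lo + q) ≡ q
  cancel′ = solve-∀
  lo+d≡x : lo + + d ≡ x
  lo+d≡x = trans (cong (λ q → lo + q) (0≤i⇒+∣i∣≡i (i≤j⇒0≤j-i lo≤x))) (cancel lo x)
  d<m : d ℕ.< m
  d<m = drop‿+<+ (subst₂ _<_ (cancel′ lo (+ d)) (cancel′ lo (+ m))
          (+-monoʳ-< (- lo) (subst (_< lo + + m) (sym lo+d≡x) x<lo+m)))

image-fibres-finite : ∀ n .{{_ : ℕ.NonZero n}} → OrderPreserving g → Equivariant (+ n) g →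
                      ∀ a → ∃ (λ z → g z ≡ a) → FiniteSet (Preimage g a)
image-fibres-finite {g} n mono equi a (z , refl) =
  applyUpTo (λ i → z - + n + + i) (n ℕ.+ n) ,
  λ x gx≡gz → ∈-interval (n ℕ.+ n) (<⇒≤ (above x gx≡gz))
                 (subst (x <_) (widen z (+ n)) (below x gx≡gz))
  where
  open ≤-Reasoning
  widen : ∀ z p → z + p ≡ z - p + (p + p)
  widen = solve-∀
  y+n≰y : ∀ y → ¬ (y + + n ≤ y)
  y+n≰y y = <⇒≱ (subst (_< y + + n) (+-identityʳ y) (+-monoʳ-< y (+<+ (ℕ.>-nonZero⁻¹ n))))
  below : ∀ x → g x ≡ g z → x < z + + n
  below x gx≡gz = ≰⇒> λ z+n≤x → y+n≰y (g z) (begin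
    g z + + n    ≡⟨ equi z ⟨
    g (z + + n)  ≤⟨ mono z+n≤x ⟩
    g x          ≡⟨ gx≡gz ⟩
    g z          ∎)
  above : ∀ x → g x ≡ g z → z - + n < x
  above x gx≡gz = ≰⇒> λ x≤z-n → y+n≰y (g z) (begin
    g z + + n    ≡⟨ cong (_+ + n) gx≡gz ⟨
    g x + + n    ≡⟨ equi x ⟨
    g (x + + n)  ≤⟨ mono (i≤j-k⇒i+k≤j x≤z-n) ⟩
    g z          ∎)

IsMaximum : (ℤ → Set) → ℤ → Set
IsMaximum P m = P m × (∀ a → P a → a ≤ m)

maximum-exists : ∀ {P : ℤ → Set} → Decidable P → ∀ {lo hi} →
                 P lo → (∀ a → P a → a ≤ hi) → Σ ℤ (IsMaximum P)
maximum-exists {P} P? {lo} {hi} Plo bounded = search ∣ hi - lo ∣ hi hi-∣hi-lo∣≡lo bounded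
  where
  pred-step : ∀ t k → -1ℤ + t - k ≡ t - (1ℤ + k)
  pred-step = solve-∀
  cancel : ∀ hi lo → hi - (hi - lo) ≡ lo
  cancel = solve-∀
  hi-∣hi-lo∣≡lo : hi - + ∣ hi - lo ∣ ≡ lo
  hi-∣hi-lo∣≡lo =
    trans (cong (λ d → hi - d) (0≤i⇒+∣i∣≡i (i≤j⇒0≤j-i (bounded lo Plo)))) (cancel hi lo)
  search : ∀ k t → t - + k ≡ lo → (∀ a → P a → a ≤ t) → Σ ℤ (IsMaximum P)
  search ℕ.zero t t≡lo bounded =
    t , subst P (sym (trans (sym (+-identityʳ t)) t≡lo)) Plo , bounded
  search (ℕ.suc k) t t-k≡lo bounded with P? t
  ... | yes Pt = t , Pt , bounded
  ... | no ¬Pt = search k (pred t) (trans (pred-step t (+ k)) t-k≡lo)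
                   λ a Pa → i<j⇒i≤pred[j] (≤∧≢⇒< (bounded a Pa) λ { refl → ¬Pt Pa })

residual-exists : ∀ n .{{_ : ℕ.NonZero n}} → OrderPreserving g → Equivariant (+ n) g →
                  Σ (ℤ → ℤ) (IsResidual g)
residual-exists {g} n mono equi = (λ b → proj₁ (maximum b)) , (λ b → proj₂ (maximum b))
  where
  g[k*n] : ∀ k → g (k * + n) ≡ g 0ℤ + k * + n
  g[k*n] k = trans (cong g (sym (+-identityˡ _))) (equivariant-* {+ n} {g} equi k 0ℤ)
  cancel : ∀ x b → x + (b - x) ≡ b
  cancel = solve-∀
  maximum : ∀ b → Σ ℤ (IsMaximum (λ a → g a ≤ b))
  maximum b = maximum-exists (λ a → g a ≤? b) g[q*n]≤b bounded
    where
    open ≤-Reasoning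
    q = (b - g 0ℤ) /ℕ n
    g[q*n]≤b : g (q * + n) ≤ b
    g[q*n]≤b = begin
      g (q * + n)          ≡⟨ g[k*n] q ⟩
      g 0ℤ + q * + n       ≤⟨ +-monoʳ-≤ (g 0ℤ) ([n/ℕd]*d≤n (b - g 0ℤ) n) ⟩
      g 0ℤ + (b - g 0ℤ)    ≡⟨ cancel (g 0ℤ) b ⟩
      b                    ∎
    bounded : ∀ a → g a ≤ b → a ≤ pred (suc q * + n)
    bounded a ga≤b = i<j⇒i≤pred[j] (≰⇒> λ [q+1]*n≤a → <⇒≱ (begin-strict
      b                    ≡⟨ cancel (g 0ℤ) b ⟨
      g 0ℤ + (b - g 0ℤ)    <⟨ +-monoʳ-< (g 0ℤ) (n<s[n/ℕd]*d (b - g 0ℤ) n) ⟩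
      g 0ℤ + suc q * + n   ≡⟨ g[k*n] (suc q) ⟨
      g (suc q * + n)      ≤⟨ mono [q+1]*n≤a ⟩
      g a                  ∎) ga≤b)

InFn⇒monotone-equivariant : ∀ n → InFn n f → OrderPreserving f × Equivariant (+ n) f
InFn⇒monotone-equivariant {f} n (mono , R , L , (R₀ , R-res) , (L₀ , L-dual) , Lₙ≗Rₙ) =
  mono , descend n Rₙ-equivariant
  where
  R-mono : ∀ k → OrderPreserving (R k)
  R-mono ℕ.zero {x} {y} x≤y = subst₂ _≤_ (sym (R₀ x)) (sym (R₀ y)) (mono x≤y)
  R-mono (ℕ.suc k) = residual-monotone (R-res k)
  L≗shiftR : ∀ k → L k ≗ shift (+ k) (R k)
  L≗shiftR ℕ.zero x = trans (L₀ x) (trans (sym (R₀ x)) (sym (shift-zero (R 0) x)))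
  L≗shiftR (ℕ.suc k) = dualResidual-unique (L-dual k)
    (dualResidual-resp-≗ (λ x → sym (L≗shiftR k x))
      (dualResidual-shift (R-mono k) (R-res k) (+ k)))
  Rₙ-equivariant : Equivariant (+ n) (R n)
  Rₙ-equivariant = shift-invariant⇒equivariant λ x → trans (sym (L≗shiftR n x)) (Lₙ≗Rₙ x)
  descend : ∀ k → Equivariant (+ n) (R k) → Equivariant (+ n) f
  descend ℕ.zero equi x = trans (sym (R₀ (x + + n))) (trans (equi x) (cong (_+ + n) (R₀ x)))
  descend (ℕ.suc k) equi = descend k (equivariant-of-residual (R-mono k) (R-res k) equi)

MonotoneEquivariant : ℤ → Set
MonotoneEquivariant p = Σ (ℤ → ℤ) λ g → OrderPreserving g × Equivariant p g

module _ (n : ℕ) .{{_ : ℕ.NonZero n}} where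

  residualᴹ : MonotoneEquivariant (+ n) → MonotoneEquivariant (+ n)
  residualᴹ (g , mono , equi) =
    proj₁ r , residual-monotone (proj₂ r) , residual-equivariant mono (proj₂ r) equi
    where r = residual-exists n mono equi

  residualᴹ-isResidual : ∀ e → IsResidual (proj₁ e) (proj₁ (residualᴹ e))
  residualᴹ-isResidual (g , mono , equi) = proj₂ (residual-exists n mono equi)

  monotone-equivariant⇒InFn : OrderPreserving f → Equivariant (+ n) f → InFn n f
  monotone-equivariant⇒InFn {f} mono equi =
    mono , R , L , ((λ _ → refl) , R-res) , (shift-zero f , L-dual) , Lₙ≗Rₙ
    where
    residuals : ℕ → MonotoneEquivariant (+ n)
    residuals ℕ.zero = f , mono , equi
    residuals (ℕ.suc k) = residualᴹ (residuals k)
    R : ℕ → ℤ → ℤ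
    R k = proj₁ (residuals k)
    R-res : ∀ k → IsResidual (R k) (R (ℕ.suc k))
    R-res k = residualᴹ-isResidual (residuals k)
    L : ℕ → ℤ → ℤ
    L k = shift (+ k) (R k)
    L-dual : ∀ k → IsDualResidual (L k) (L (ℕ.suc k))
    L-dual k = dualResidual-shift (proj₁ (proj₂ (residuals k))) (R-res k) (+ k)
    Lₙ≗Rₙ : ∀ x → L n x ≡ R n x
    Lₙ≗Rₙ = equivariant⇒shift-invariant (proj₂ (proj₂ (residuals n)))

lemma2p9 : (n : ℕ) → 1 Data.Nat.≤ n → (f : ℤ → ℤ) →
    InFn n f ⇔
      ((∀ a → (∃ λ z → f z ≡ a) → FiniteSet (Preimage f a))
       × (∀ x y k → x ≤ y + k * + n → f x ≤ f y + k * + n))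
lemma2p9 n 1≤n f = mk⇔
  (λ inFn → let (mono , equi) = InFn⇒monotone-equivariant n inFn
            in image-fibres-finite n mono equi , Equivalence.to bounds⇔ (mono , equi))
  (λ (_ , bound) → let (mono , equi) = Equivalence.from bounds⇔ bound
                   in monotone-equivariant⇒InFn n mono equi)
  where
  instance
    n≢0 : ℕ.NonZero n
    n≢0 = ℕ.>-nonZero 1≤n
  bounds⇔ : (OrderPreserving f × Equivariant (+ n) f) ⇔
            (∀ x y k → x ≤ y + k * + n → f x ≤ f y + k * + n)
  bounds⇔ = monotone-equivariant⇔
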